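{- For every integer $n\geq 3$, the wheel $W_n$ satisfies $\chi_{md}(W_n)=4$ if $n$ is odd and $\chi_{md}(W_n)=3$ if $n$ is even.
   Context: The wheel $W_n$ is obtained from the cycle $C_n$ by adding one central vertex adjacent to all $n$ cycle vertices. For a vertex $v$, $N[v]=N(v)\cup\{v\}$; $v$ dominates exactly the vertices of $N[v]$. A majority dominator coloring of $G$ is a proper vertex coloring such that for every vertex $v$ there is a color class $C$ with $|N[v]\cap C|\geq |C|/2$. $\chi_{md}(G)$ is the minimum number of color classes in a majority dominator coloring of $G$. -}

module Defs where

open import Data.Nat using (ℕ; zero; suc; _≤_; _*_; _≡ᵇ_)
open import Data.Fin using (Fin; toℕ) renaming (zero to fz; suc to fs)
open import Data.Bool using (Bool; true; false; _∨_; _∧_; if_then_else_)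
open import Data.List using (List; length; filterᵇ)
open import Data.List using () renaming (allFin to allFinL)
open import Data.Product using (Σ; ∃; _×_)
open import Relation.Binary.PropositionalEquality using (_≡_; _≢_)

Adj : ℕ → Set
Adj m = Fin m → Fin m → Bool

nextMod : ℕ → ℕ → ℕ
nextMod n a = if suc a ≡ᵇ n then 0 else suc a

cycleAdj : (n : ℕ) → Adj n
cycleAdj n i j = (toℕ j ≡ᵇ nextMod n (toℕ i)) ∨ (toℕ i ≡ᵇ nextMod n (toℕ j))

wheel : (n : ℕ) → Adj (suc n)
wheel n fz     fz     = false
wheel n fz     (fs _) = true
wheel n (fs _) fz     = true
wheel n (fs i) (fs j) = cycleAdj n i j

count : {m : ℕ} → (Fin m → Bool) → ℕ
count {m} p = length (filterᵇ p (allFinL m))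

inClosedNbhd : {m : ℕ} → Adj m → Fin m → Fin m → Bool
inClosedNbhd adj v u = (toℕ v ≡ᵇ toℕ u) ∨ adj v u

inClass : {m k : ℕ} → (Fin m → Fin k) → Fin k → Fin m → Bool
inClass c col u = toℕ (c u) ≡ᵇ toℕ col

classSize : {m k : ℕ} → (Fin m → Fin k) → Fin k → ℕ
classSize c col = count (inClass c col)

nbhdInClass : {m k : ℕ} → Adj m → (Fin m → Fin k) → Fin m → Fin k → ℕ
nbhdInClass adj c v col = count (λ u → inClosedNbhd adj v u ∧ inClass c col u)

Proper : {m k : ℕ} → Adj m → (Fin m → Fin k) → Set
Proper adj c = ∀ u v → adj u v ≡ true → c u ≢ c v

-- every one of the k colours is used, so there are exactly k colour classes
AllColoursUsed : {m k : ℕ} → (Fin m → Fin k) → Set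
AllColoursUsed {m} c = ∀ col → ∃ λ (v : Fin m) → c v ≡ col

-- a majority dominator colouring with exactly k colour classes:
-- proper, and every v has a class C with |N[v] ∩ C| ≥ |C|/2, i.e. |C| ≤ 2|N[v] ∩ C|
IsMDColouring : {m : ℕ} → Adj m → (k : ℕ) → (Fin m → Fin k) → Set
IsMDColouring adj k c =
  Proper adj c × AllColoursUsed c ×
  (∀ v → ∃ λ col → classSize c col ≤ 2 * nbhdInClass adj c v col)

ChiMD≡ : {m : ℕ} → Adj m → ℕ → Set
ChiMD≡ {m} adj k =
  (∃ λ (c : Fin m → Fin k) → IsMDColouring adj k c) ×
  (∀ (k' : ℕ) (c : Fin m → Fin k') → IsMDColouring adj k' c → k ≤ k')

-- Colour the centre alone and the rim properly: the centre's class {centre} lies in every closed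
-- neighbourhood, so it is a majority class for every vertex.  The rim of an even wheel takes two
-- colours (parity), that of an odd wheel three (parity, with the last vertex recoloured), giving
-- 3 resp. 4 classes.  Conversely the centre and two consecutive rim vertices form a triangle, and
-- in a proper 3-colouring the rim would alternate between the two remaining colours, which is
-- impossible around an odd cycle.
module Submission where

open import Defs
open import Data.Nat using (ℕ; zero; suc; _≤_; _<_; _*_; _+_; _≡ᵇ_; _≟_; z≤n; s≤s)
open import Data.Nat.Properties
  using (≡ᵇ⇒≡; ≡⇒≡ᵇ; +-suc; +-comm; <⇒≢; ≤-trans; ≤-reflexive; m+n≤o⇒n≤o; m≤n*m; m≤n⇒m<n∨m≡n)
open import Data.Fin using (Fin; toℕ; fromℕ; fromℕ<; inject₁) renaming (zero to fz; suc to fs)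
open import Data.Fin.Properties
  using (toℕ-fromℕ<; toℕ-fromℕ; suc-injective; punchOut-injective; injective⇒≤; fromℕ≢inject₁; inject₁-injective)
open import Data.Bool using (true; false)
open import Data.Bool.Properties using (T-≡; T-∨)
open import Data.List using (length)
open import Data.List.Properties using (filter-none)
open import Data.List.Relation.Unary.All.Properties using (tabulate⁺)
open import Data.Sum using (_⊎_; inj₁; inj₂; map)
open import Data.Product using (_×_; _,_; proj₁; ∃)
open import Function using (_∘_; Injective)
open import Function.Bundles using (Equivalence)
open import Relation.Nullary using (¬_; yes; no; contradiction)
open import Relation.Nullary.Decidable using (T?)
open import Relation.Binary.PropositionalEquality using (_≡_; _≢_; refl; sym; trans; cong; subst)

open Equivalence using (to; from)

≡ᵇ-refl : ∀ m → (m ≡ᵇ m) ≡ true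
≡ᵇ-refl m = T-≡ .to (≡⇒≡ᵇ m m refl)

nextMod-last : ∀ {n a} → suc a ≡ n → nextMod n a ≡ 0
nextMod-last {a = a} refl rewrite ≡ᵇ-refl a = refl

nextMod-notLast : ∀ {n a} → suc a ≢ n → nextMod n a ≡ suc a
nextMod-notLast {n} {a} last≢n with suc a ≡ᵇ n in eq
... | false = refl
... | true  = contradiction (≡ᵇ⇒≡ _ _ (T-≡ .from eq)) last≢n

cycleAdj-next : ∀ {n} {i j : Fin n} → toℕ j ≡ nextMod n (toℕ i) → cycleAdj n i j ≡ true
cycleAdj-next j≡next = T-≡ .to (T-∨ .from (inj₁ (≡⇒≡ᵇ _ _ j≡next)))

cycleAdj-sound : ∀ {n} {i j : Fin n} → cycleAdj n i j ≡ true →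
                 toℕ j ≡ nextMod n (toℕ i) ⊎ toℕ i ≡ nextMod n (toℕ j)
cycleAdj-sound adj = map (≡ᵇ⇒≡ _ _) (≡ᵇ⇒≡ _ _) (T-∨ .to (T-≡ .from adj))

cycleAdj-fromℕ< : ∀ {n i j} .(i<n : i < n) .(j<n : j < n) → j ≡ nextMod n i →
                  cycleAdj n (fromℕ< i<n) (fromℕ< j<n) ≡ true
cycleAdj-fromℕ< {n} i<n j<n j≡next =
  cycleAdj-next (trans (toℕ-fromℕ< j<n) (trans j≡next (cong (nextMod n) (sym (toℕ-fromℕ< i<n)))))

-- Rim colourings are indexed by ℕ so that the cycle successor is nextMod; properness is required
-- for every a, not only for a < n, which is harmless for the colourings used here.
ProperOnCycle : ℕ → {k : ℕ} → (ℕ → Fin k) → Set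
ProperOnCycle n col = ∀ a → col a ≢ col (nextMod n a)

properOnCycle : ∀ {n k} {col : ℕ → Fin k} →
                (∀ a → suc a ≢ n → col a ≢ col (suc a)) →
                (∀ a → suc a ≡ n → col a ≢ col 0) →
                ProperOnCycle n col
properOnCycle {n} {col = col} step wrap a with suc a ≟ n
... | yes last = subst (λ b → col a ≢ col b) (sym (nextMod-last last)) (wrap a last)
... | no ¬last = subst (λ b → col a ≢ col b) (sym (nextMod-notLast ¬last)) (step a ¬last)

wheelColouring : ∀ n {k} → (ℕ → Fin k) → Fin (suc n) → Fin (suc k)
wheelColouring n col fz     = fz
wheelColouring n col (fs i) = fs (col (toℕ i))

wheelColouring-proper : ∀ {n k} {col : ℕ → Fin k} → ProperOnCycle n col →
                        Proper (wheel n) (wheelColouring n col)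
wheelColouring-proper proper fz     fz     ()
wheelColouring-proper proper fz     (fs j) _   ()
wheelColouring-proper proper (fs i) fz     _   ()
wheelColouring-proper {col = col} proper (fs i) (fs j) adj same with cycleAdj-sound adj
... | inj₁ j≡next = proper (toℕ i) (trans (suc-injective same) (cong col j≡next))
... | inj₂ i≡next = proper (toℕ j) (trans (sym (suc-injective same)) (cong col i≡next))

wheelColouring-centreClass : ∀ {n k} (col : ℕ → Fin k) → classSize (wheelColouring n col) fz ≡ 1
wheelColouring-centreClass {n} col =
  cong (suc ∘ length) (filter-none (T? ∘ inClass (wheelColouring n col) fz) (tabulate⁺ {f = fs} λ _ ()))

wheelColouring-centreInNbhd : ∀ {n k} (col : ℕ → Fin k) v →
                              1 ≤ nbhdInClass (wheel n) (wheelColouring n col) v fz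
wheelColouring-centreInNbhd col fz     = s≤s z≤n
wheelColouring-centreInNbhd col (fs v) = s≤s z≤n

wheelColouring-isMD : ∀ {n k} (col : ℕ → Fin k) → ProperOnCycle n col →
                      (∀ x → ∃ λ (i : Fin n) → col (toℕ i) ≡ x) →
                      IsMDColouring (wheel n) (suc k) (wheelColouring n col)
wheelColouring-isMD {n} col proper onto = wheelColouring-proper proper , used , λ v → fz , centreDominates v
  where
  used : AllColoursUsed (wheelColouring n col)
  used fz     = fz , refl
  used (fs x) with onto x
  ... | i , colᵢ≡x = fs i , cong fs colᵢ≡x

  centreDominates : ∀ v → classSize (wheelColouring n col) fz ≤ 2 * nbhdInClass (wheel n) (wheelColouring n col) v fz
  centreDominates v = subst (_≤ 2 * nbhdInClass (wheel n) (wheelColouring n col) v fz)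
                        (sym (wheelColouring-centreClass {n} col))
                        (≤-trans (wheelColouring-centreInNbhd {n} col v) (m≤n*m _ 2))

parity : ℕ → Fin 2
parity zero          = fz
parity (suc zero)    = fs fz
parity (suc (suc a)) = parity a

parity-suc : ∀ a → parity (suc a) ≢ parity a
parity-suc zero          ()
parity-suc (suc zero)    ()
parity-suc (suc (suc a)) = parity-suc a

parity-double : ∀ t → parity (2 * t) ≡ fz
parity-double zero    = refl
parity-double (suc t) rewrite +-suc t (t + 0) = parity-double t

parity-properOnCycle : ∀ {n} t → n ≡ 2 * t → ProperOnCycle n parity
parity-properOnCycle t n≡2t = properOnCycle (λ a _ → parity-suc a ∘ sym) wrap
  where
  wrap : ∀ a → suc a ≡ _ → parity a ≢ parity 0
  wrap a last parityₐ≡0 = parity-suc a (trans (cong parity (trans last n≡2t)) (trans (parity-double t) (sym parityₐ≡0)))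

parity-onto : ∀ {m} x → ∃ λ (i : Fin (suc (suc m))) → parity (toℕ i) ≡ x
parity-onto fz      = fz , refl
parity-onto (fs fz) = fs fz , refl

oddRimColouring : ℕ → ℕ → Fin 3
oddRimColouring n a with suc a ≟ n
... | yes _ = fromℕ 2
... | no  _ = inject₁ (parity a)

oddRimColouring-last : ∀ a → oddRimColouring (suc a) a ≡ fromℕ 2
oddRimColouring-last a with suc a ≟ suc a
... | yes _   = refl
... | no  a≢a = contradiction refl a≢a

oddRimColouring-properOnCycle : ∀ {n} → 1 < n → ProperOnCycle n (oddRimColouring n)
oddRimColouring-properOnCycle {n} 1<n = properOnCycle step wrap
  where
  step : ∀ a → suc a ≢ n → oddRimColouring n a ≢ oddRimColouring n (suc a)
  step a ¬last with suc a ≟ n | suc (suc a) ≟ n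
  ... | yes last | _     = contradiction last ¬last
  ... | no _     | yes _ = fromℕ≢inject₁ ∘ sym
  ... | no _     | no _  = parity-suc a ∘ sym ∘ inject₁-injective

  wrap : ∀ a → suc a ≡ n → oddRimColouring n a ≢ oddRimColouring n 0
  wrap a last with suc a ≟ n | 1 ≟ n
  ... | no ¬last | _       = contradiction last ¬last
  ... | yes _    | yes 1≡n = contradiction 1≡n (<⇒≢ 1<n)
  ... | yes _    | no _    = fromℕ≢inject₁

oddRimColouring-onto : ∀ {m} x → ∃ λ (i : Fin (suc (suc (suc m)))) → oddRimColouring (suc (suc (suc m))) (toℕ i) ≡ x
oddRimColouring-onto     fz           = fz , refl
oddRimColouring-onto     (fs fz)      = fs fz , refl
oddRimColouring-onto {m} (fs (fs fz)) =
  fromℕ (suc (suc m)) ,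
  trans (cong (oddRimColouring (suc (suc (suc m)))) (toℕ-fromℕ (suc (suc m)))) (oddRimColouring-last (suc (suc m)))

distinct⇒3≤ : ∀ {k} {x y z : Fin k} → x ≢ y → y ≢ z → x ≢ z → 3 ≤ k
distinct⇒3≤ {k} {x} {y} {z} x≢y y≢z x≢z = injective⇒≤ {f = triple} triple-injective
  where
  triple : Fin 3 → Fin k
  triple fz           = x
  triple (fs fz)      = y
  triple (fs (fs fz)) = z

  triple-injective : Injective _≡_ _≡_ triple
  triple-injective {fz}           {fz}           _ = refl
  triple-injective {fs fz}        {fs fz}        _ = refl
  triple-injective {fs (fs fz)}   {fs (fs fz)}   _ = refl
  triple-injective {fz}           {fs fz}        e = contradiction e x≢y
  triple-injective {fz}           {fs (fs fz)}   e = contradiction e x≢z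
  triple-injective {fs fz}        {fz}           e = contradiction (sym e) x≢y
  triple-injective {fs fz}        {fs (fs fz)}   e = contradiction e y≢z
  triple-injective {fs (fs fz)}   {fz}           e = contradiction (sym e) x≢z
  triple-injective {fs (fs fz)}   {fs fz}        e = contradiction (sym e) y≢z

wheel-3≤colours : ∀ {n k} (c : Fin (suc (suc (suc n))) → Fin k) → Proper (wheel (suc (suc n))) c → 3 ≤ k
wheel-3≤colours c proper =
  distinct⇒3≤ (proper fz (fs fz) refl) (proper (fs fz) (fs (fs fz)) refl) (proper fz (fs (fs fz)) refl)

fin2-alternating : ∀ {x y z : Fin 2} → x ≢ y → y ≢ z → x ≡ z
fin2-alternating {fz}    {_}     {fz}    _   _   = refl
fin2-alternating {fs fz} {_}     {fs fz} _   _   = refl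
fin2-alternating {fz}    {fz}    {fs fz} x≢y _   = contradiction refl x≢y
fin2-alternating {fz}    {fs fz} {fs fz} _   y≢z = contradiction refl y≢z
fin2-alternating {fs fz} {fz}    {fz}    _   y≢z = contradiction refl y≢z
fin2-alternating {fs fz} {fs fz} {fz}    x≢y _   = contradiction refl x≢y

fin3-alternating-avoiding : ∀ {a x y z : Fin 3} (a≢x : a ≢ x) (a≢y : a ≢ y) (a≢z : a ≢ z) →
                            x ≢ y → y ≢ z → x ≡ z
fin3-alternating-avoiding a≢x a≢y a≢z x≢y y≢z =
  punchOut-injective a≢x a≢z
    (fin2-alternating (x≢y ∘ punchOut-injective a≢x a≢y) (y≢z ∘ punchOut-injective a≢y a≢z))

oddWheel-no3Colouring : ∀ {n} t (c : Fin (suc n) → Fin 3) → n ≡ 2 * t + 1 → ¬ Proper (wheel n) c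
oddWheel-no3Colouring {n} t c n≡2t+1 proper =
  proper (fs (fromℕ< last<n)) (fs (fromℕ< 0<n)) lastAdjFirst (rim-even (2 * t) last<n (parity-double t))
  where
  n≡1+2t : n ≡ suc (2 * t)
  n≡1+2t = trans n≡2t+1 (+-comm (2 * t) 1)

  last<n : 2 * t < n
  last<n = ≤-reflexive (sym n≡1+2t)

  0<n : 0 < n
  0<n = ≤-trans (s≤s z≤n) last<n

  rim : (i : ℕ) → .(i < n) → Fin 3
  rim i i<n = c (fs (fromℕ< i<n))

  rim-avoidsCentre : ∀ i .(i<n : i < n) → c fz ≢ rim i i<n
  rim-avoidsCentre i i<n = proper fz (fs (fromℕ< i<n)) refl

  rim-adjacent : ∀ i (1+i<n : suc i < n) → rim i (m+n≤o⇒n≤o 1 1+i<n) ≢ rim (suc i) 1+i<n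
  rim-adjacent i 1+i<n =
    proper _ _ (cycleAdj-fromℕ< (m+n≤o⇒n≤o 1 1+i<n) 1+i<n (sym (nextMod-notLast (<⇒≢ 1+i<n))))

  rim-twoStep : ∀ i (2+i<n : suc (suc i) < n) → rim (suc (suc i)) 2+i<n ≡ rim i (m+n≤o⇒n≤o 2 2+i<n)
  rim-twoStep i 2+i<n = sym (fin3-alternating-avoiding
    (rim-avoidsCentre i _) (rim-avoidsCentre (suc i) _) (rim-avoidsCentre (suc (suc i)) _)
    (rim-adjacent i (m+n≤o⇒n≤o 1 2+i<n)) (rim-adjacent (suc i) 2+i<n))

  rim-even : ∀ i (i<n : i < n) → parity i ≡ fz → rim i i<n ≡ rim 0 0<n
  rim-even zero          _     _    = refl
  rim-even (suc zero)    _     ()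
  rim-even (suc (suc i)) 2+i<n even = trans (rim-twoStep i 2+i<n) (rim-even i (m+n≤o⇒n≤o 2 2+i<n) even)

  lastAdjFirst : wheel n (fs (fromℕ< last<n)) (fs (fromℕ< 0<n)) ≡ true
  lastAdjFirst = cycleAdj-fromℕ< last<n 0<n (sym (nextMod-last (sym n≡1+2t)))

oddWheel-4≤colours : ∀ {n} k t (c : Fin (suc (suc (suc n))) → Fin k) → suc (suc n) ≡ 2 * t + 1 →
                     Proper (wheel (suc (suc n))) c → 4 ≤ k
oddWheel-4≤colours k t c odd proper with m≤n⇒m<n∨m≡n (wheel-3≤colours c proper)
... | inj₁ 3<k = 3<k
... | inj₂ refl = contradiction proper (oddWheel-no3Colouring t c odd)

mainTheorem11 : (n : ℕ) → 3 ≤ n →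
    (∀ (t : ℕ) → n ≡ 2 * t + 1 → ChiMD≡ (wheel n) 4) ×
    (∀ (t : ℕ) → n ≡ 2 * t → ChiMD≡ (wheel n) 3)
mainTheorem11 n@(suc (suc (suc m))) (s≤s (s≤s (s≤s _))) = odd , even
  where
  odd : ∀ t → n ≡ 2 * t + 1 → ChiMD≡ (wheel n) 4
  odd t n-odd =
    (wheelColouring n (oddRimColouring n) ,
     wheelColouring-isMD (oddRimColouring n) (oddRimColouring-properOnCycle (s≤s (s≤s z≤n))) oddRimColouring-onto) ,
    λ k c md → oddWheel-4≤colours k t c n-odd (proj₁ md)

  even : ∀ t → n ≡ 2 * t → ChiMD≡ (wheel n) 3
  even t n-even =
    (wheelColouring n parity , wheelColouring-isMD parity (parity-properOnCycle t n-even) parity-onto) ,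
    λ k c md → wheel-3≤colours c (proj₁ md)
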